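{- For every positive integer $k$, with $n = 3^k$ and $A_k = \{x \in \{0,1\}^n : \mathrm{RecMaj}_k(x) = 1\}$, there exists a bijection $\phi \colon \{0,1\}^{n-1} \to A_k$ such that $\mathrm{avgstretch}(\phi) \le 20$.
   Context: The recursive majority of 3's, $\mathrm{RecMaj}_k \colon \{0,1\}^{3^k} \to \{0,1\}$, is defined by: $\mathrm{RecMaj}_1$ is the majority of its 3 input bits; for $k>1$, writing $x = x^{(1)} \circ x^{(2)} \circ x^{(3)}$ with each $x^{(r)} \in \{0,1\}^{3^{k-1}}$ (consecutive thirds), $\mathrm{RecMaj}_k(x) = \mathrm{Maj}(\mathrm{RecMaj}_{k-1}(x^{(1)}),\mathrm{RecMaj}_{k-1}(x^{(2)}),\mathrm{RecMaj}_{k-1}(x^{(3)}))$. One has $|A_k| = 2^{n-1}$. $\mathrm{dist}$ is the Hamming distance, and for a bijection $\phi \colon \{0,1\}^{n-1} \to A_k$, $\mathrm{avgstretch}(\phi) = \mathbb{E}[\mathrm{dist}(\phi(x),\phi(x'))]$ over a uniformly random pair $x,x' \in \{0,1\}^{n-1}$ differing in exactly one coordinate. -}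

module Defs where

open import Data.Bool using (Bool; true; false; _∧_; _∨_; _xor_; not)
open import Data.Nat using (ℕ; zero; suc; _+_; _*_; _^_; _∸_; _≤_)
open import Data.Vec using (Vec; []; _∷_; take; drop; head; updateAt; zipWith; toList)
open import Data.Fin using (Fin)
open import Data.Nat.ListAction using (sum)
open import Data.List using (List; []; _∷_; map; concatMap; _++_)
open import Data.List using () renaming (allFin to allFinL)
open import Data.Product using (Σ; _,_; proj₁)
open import Relation.Binary.PropositionalEquality using (_≡_)
open import Function.Definitions using (Bijective)

maj : Bool → Bool → Bool → Bool
maj a b c = (a ∧ b) ∨ (a ∧ c) ∨ (b ∧ c)

-- recMaj k : {0,1}^(3^k) → {0,1}.  recMaj 0 is the identity on the single bit,
-- so recMaj 1 = maj of its three bits, and recMaj (k+1) applies maj to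
-- recMaj k of the three consecutive thirds (3^(k+1) = 3^k + (3^k + (3^k + 0))).
recMaj : (k : ℕ) → Vec Bool (3 ^ k) → Bool
recMaj zero x = head x
recMaj (suc k) x =
  maj (recMaj k (take (3 ^ k) x))
      (recMaj k (take (3 ^ k) (drop (3 ^ k) x)))
      (recMaj k (take (3 ^ k) (drop (3 ^ k) (drop (3 ^ k) x))))

A : (k : ℕ) → Set
A k = Σ (Vec Bool (3 ^ k)) (λ x → recMaj k x ≡ true)

dist : {n : ℕ} → Vec Bool n → Vec Bool n → ℕ
dist [] [] = 0
dist (a ∷ x) (b ∷ y) = (if-xor a b) + dist x y
  where
  if-xor : Bool → Bool → ℕ
  if-xor true false = 1
  if-xor false true = 1
  if-xor _ _ = 0

allVecs : (m : ℕ) → List (Vec Bool m)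
allVecs zero = [] ∷ []
allVecs (suc m) = map (false ∷_) (allVecs m) ++ map (true ∷_) (allVecs m)

flipAt : {m : ℕ} → Fin m → Vec Bool m → Vec Bool m
flipAt i x = updateAt x i not

-- Total stretch: sum over all ordered pairs (x, x') differing in exactly one
-- coordinate, i.e. over all x ∈ {0,1}^m and i ∈ [m] with x' = x ⊕ e_i,
-- of dist(φ x, φ x').  There are 2^m · m such pairs, so
-- avgstretch(φ) = totalStretch φ / (2^m · m).
totalStretch : {m : ℕ} (k : ℕ) → (Vec Bool m → A k) → ℕ
totalStretch {m} k φ =
  sum (concatMap (λ x → map (λ i → dist (proj₁ (φ x)) (proj₁ (φ (flipAt i x))))
                            (allFinL m))
                 (allVecs m))

-- avgstretch(φ) ≤ c, cross-multiplied by the (positive) number 2^m · m of pairs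
AvgStretch≤ : {m : ℕ} (k : ℕ) → (Vec Bool m → A k) → ℕ → Set
AvgStretch≤ {m} k φ c = totalStretch k φ ≤ c * (2 ^ m * m)

Bijective≡ : {X Y : Set} → (X → Y) → Set
Bijective≡ f = Bijective _≡_ _≡_ f

module Submission where

-- We build, for every k, two bijections  encode b : {0,1}^(d k) → RecMaj_k⁻¹(b)
-- (b ∈ {0,1}, d 0 = 0, d (k+1) = 2 + 3·d k, so d k = 3^k − 1) and track two
-- numbers: the total stretch  T b  of  encode b  (sum of dist over all
-- hypercube edges) and the cross distance  D = Σ_y dist(encode 1 y, encode 0 y).
-- At level k+1 the first two input bits  s  choose one of the four triples
-- (r₁,r₂,r₃) with majority t, and the remaining 3·d k bits are encoded blockwise
-- by  encode r₁ , encode r₂ , encode r₃ .  Two general facts compute the new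
-- stretch: the stretch of a map that reads an index prefix splits into the
-- stretch of its fibres plus the cross distances between neighbouring fibres,
-- and the stretch of a blockwise product is a weighted sum of the stretches of
-- the factors.  Counting on the four triples then gives, with R = 2^(2·d k),
--   T'(t) = R·(12·D + 9·T t + 3·T(¬t)),    D' = R·6·D,
-- which preserves the invariant  T b + 2D ≤ 20·2^d·d + 2·2^d  together with
-- 2^d ≤ D.  Hence T 1 ≤ 20·2^d·d, i.e. the average stretch of encode 1 is ≤ 20.

open import Defs
open import Data.Bool using (Bool; true; false; not)
open import Data.Bool.Properties using () renaming (_≟_ to _≟ᵇ_)
open import Data.Nat using (ℕ; zero; suc; _+_; _*_; _∸_; _^_; _≤_)
open import Data.Nat.Properties
open import Data.Nat.Tactic.RingSolver using (solve-∀)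
open import Data.Vec using (Vec; []; _∷_; _++_; take; drop)
open import Data.Vec.Properties using (take++drop≡id; ++-injectiveˡ; ++-injectiveʳ)
open import Data.Fin using (Fin; zero; suc; _↑ˡ_; _↑ʳ_)
open import Data.Product using (Σ; _×_; _,_; proj₁)
import Data.List as List
import Data.List.Properties as List
open import Data.Nat.ListAction using (sum)
open import Data.Nat.ListAction.Properties using (sum-++)
open import Axiom.UniquenessOfIdentityProofs using (module Decidable⇒UIP)
open import Relation.Binary.PropositionalEquality

sumCube : (m : ℕ) → (Vec Bool m → ℕ) → ℕ
sumCube zero    f = f []
sumCube (suc m) f = sumCube m (λ x → f (false ∷ x)) + sumCube m (λ x → f (true ∷ x))

sumFin : (m : ℕ) → (Fin m → ℕ) → ℕ
sumFin zero    h = 0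
sumFin (suc m) h = h zero + sumFin m (λ i → h (suc i))

sumCube-cong : ∀ m {f g : Vec Bool m → ℕ} → (∀ x → f x ≡ g x) → sumCube m f ≡ sumCube m g
sumCube-cong zero    e = e []
sumCube-cong (suc m) e =
  cong₂ _+_ (sumCube-cong m (λ x → e (false ∷ x))) (sumCube-cong m (λ x → e (true ∷ x)))

sumFin-cong : ∀ m {f g : Fin m → ℕ} → (∀ i → f i ≡ g i) → sumFin m f ≡ sumFin m g
sumFin-cong zero    e = refl
sumFin-cong (suc m) e = cong₂ _+_ (e zero) (sumFin-cong m (λ i → e (suc i)))

sumCube-+ : ∀ m (f g : Vec Bool m → ℕ) →
  sumCube m (λ x → f x + g x) ≡ sumCube m f + sumCube m g
sumCube-+ zero    f g = refl
sumCube-+ (suc m) f g =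
  trans (cong₂ _+_ (sumCube-+ m (λ x → f (false ∷ x)) (λ x → g (false ∷ x)))
                   (sumCube-+ m (λ x → f (true ∷ x)) (λ x → g (true ∷ x))))
        (interchange (sumCube m (λ x → f (false ∷ x))) (sumCube m (λ x → f (true ∷ x)))
                     (sumCube m (λ x → g (false ∷ x))) (sumCube m (λ x → g (true ∷ x))))
  where
  interchange : ∀ a b c d → (a + c) + (b + d) ≡ (a + b) + (c + d)
  interchange = solve-∀

sumCube-*ˡ : ∀ m c (f : Vec Bool m → ℕ) → sumCube m (λ x → c * f x) ≡ c * sumCube m f
sumCube-*ˡ zero    c f = refl
sumCube-*ˡ (suc m) c f =
  trans (cong₂ _+_ (sumCube-*ˡ m c (λ x → f (false ∷ x))) (sumCube-*ˡ m c (λ x → f (true ∷ x))))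
        (sym (*-distribˡ-+ c _ _))

sumFin-*ˡ : ∀ m c (h : Fin m → ℕ) → sumFin m (λ i → c * h i) ≡ c * sumFin m h
sumFin-*ˡ zero    c h = sym (*-zeroʳ c)
sumFin-*ˡ (suc m) c h =
  trans (cong (c * h zero +_) (sumFin-*ˡ m c (λ i → h (suc i)))) (sym (*-distribˡ-+ c _ _))

sumCube-const : ∀ m c → sumCube m (λ _ → c) ≡ 2 ^ m * c
sumCube-const zero    c = sym (+-identityʳ c)
sumCube-const (suc m) c =
  trans (cong₂ _+_ (sumCube-const m c) (sumCube-const m c)) (double (2 ^ m) c)
  where
  double : ∀ p c → p * c + p * c ≡ 2 * p * c
  double = solve-∀

sumCube-++ : ∀ a b (F : Vec Bool (a + b) → ℕ) →
  sumCube (a + b) F ≡ sumCube a (λ u → sumCube b (λ w → F (u ++ w)))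
sumCube-++ zero    b F = refl
sumCube-++ (suc a) b F =
  cong₂ _+_ (sumCube-++ a b (λ x → F (false ∷ x))) (sumCube-++ a b (λ x → F (true ∷ x)))

sumFin-++ : ∀ a b (h : Fin (a + b) → ℕ) →
  sumFin (a + b) h ≡ sumFin a (λ i → h (i ↑ˡ b)) + sumFin b (λ j → h (a ↑ʳ j))
sumFin-++ zero    b h = refl
sumFin-++ (suc a) b h =
  trans (cong (h zero +_) (sumFin-++ a b (λ i → h (suc i)))) (sym (+-assoc (h zero) _ _))

sumCube-sumFin : ∀ m a (f : Vec Bool m → Fin a → ℕ) →
  sumCube m (λ x → sumFin a (f x)) ≡ sumFin a (λ i → sumCube m (λ x → f x i))
sumCube-sumFin m zero    f = trans (sumCube-const m 0) (*-zeroʳ (2 ^ m))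
sumCube-sumFin m (suc a) f =
  trans (sumCube-+ m (λ x → f x zero) (λ x → sumFin a (λ i → f x (suc i))))
        (cong (sumCube m (λ x → f x zero) +_) (sumCube-sumFin m a (λ x i → f x (suc i))))

dist-++ : ∀ {a b} (x y : Vec Bool a) (z w : Vec Bool b) →
  dist (x ++ z) (y ++ w) ≡ dist x y + dist z w
dist-++ []          []          z w = refl
dist-++ (false ∷ x) (false ∷ y) z w = dist-++ x y z w
dist-++ (false ∷ x) (true ∷ y)  z w = cong suc (dist-++ x y z w)
dist-++ (true ∷ x)  (false ∷ y) z w = cong suc (dist-++ x y z w)
dist-++ (true ∷ x)  (true ∷ y)  z w = dist-++ x y z w

dist-refl : ∀ {a} (x : Vec Bool a) → dist x x ≡ 0
dist-refl []          = refl
dist-refl (false ∷ x) = dist-refl x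
dist-refl (true ∷ x)  = dist-refl x

dist-sym : ∀ {a} (x y : Vec Bool a) → dist x y ≡ dist y x
dist-sym []          []          = refl
dist-sym (false ∷ x) (false ∷ y) = dist-sym x y
dist-sym (false ∷ x) (true ∷ y)  = cong suc (dist-sym x y)
dist-sym (true ∷ x)  (false ∷ y) = cong suc (dist-sym x y)
dist-sym (true ∷ x)  (true ∷ y)  = dist-sym x y

dist-prefix : ∀ {a b} (c : Vec Bool a) (x y : Vec Bool b) → dist (c ++ x) (c ++ y) ≡ dist x y
dist-prefix c x y = trans (dist-++ c c x y) (cong (_+ dist x y) (dist-refl c))

stretch : (m : ℕ) {n : ℕ} → (Vec Bool m → Vec Bool n) → ℕ
stretch m g = sumCube m (λ x → sumFin m (λ i → dist (g x) (g (flipAt i x))))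

cross : (m : ℕ) {n : ℕ} → (Vec Bool m → Vec Bool n) → (Vec Bool m → Vec Bool n) → ℕ
cross m g h = sumCube m (λ x → dist (g x) (h x))

cross-refl : ∀ m {n} (g : Vec Bool m → Vec Bool n) → cross m g g ≡ 0
cross-refl m g = trans (sumCube-cong m (λ x → dist-refl (g x))) (trans (sumCube-const m 0) (*-zeroʳ (2 ^ m)))

cross-sym : ∀ m {n} (g h : Vec Bool m → Vec Bool n) → cross m g h ≡ cross m h g
cross-sym m g h = sumCube-cong m (λ x → dist-sym (g x) (h x))

cross-prefixed : ∀ b {n₁ n₂} (c c' : Vec Bool n₁) (h h' : Vec Bool b → Vec Bool n₂) →
  cross b (λ w → c ++ h w) (λ w → c' ++ h' w) ≡ 2 ^ b * dist c c' + cross b h h'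
cross-prefixed b c c' h h' =
  trans (sumCube-cong b (λ w → dist-++ c c' (h w) (h' w)))
        (trans (sumCube-+ b (λ _ → dist c c') (λ w → dist (h w) (h' w)))
               (cong (_+ cross b h h') (sumCube-const b (dist c c'))))

take-++ : ∀ {A : Set} a {b} (u : Vec A a) (w : Vec A b) → take a (u ++ w) ≡ u
take-++ a u w = ++-injectiveˡ (take a (u ++ w)) u (take++drop≡id a (u ++ w))

drop-++ : ∀ {A : Set} a {b} (u : Vec A a) (w : Vec A b) → drop a (u ++ w) ≡ w
drop-++ a u w = ++-injectiveʳ (take a (u ++ w)) u (take++drop≡id a (u ++ w))

flipAt-↑ˡ : ∀ {a b} (i : Fin a) (u : Vec Bool a) (w : Vec Bool b) →
  flipAt (i ↑ˡ b) (u ++ w) ≡ flipAt i u ++ w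
flipAt-↑ˡ zero    (x ∷ u) w = refl
flipAt-↑ˡ (suc i) (x ∷ u) w = cong (x ∷_) (flipAt-↑ˡ i u w)

flipAt-↑ʳ : ∀ {a b} (j : Fin b) (u : Vec Bool a) (w : Vec Bool b) →
  flipAt (a ↑ʳ j) (u ++ w) ≡ u ++ flipAt j w
flipAt-↑ʳ j []      w = refl
flipAt-↑ʳ j (x ∷ u) w = cong (x ∷_) (flipAt-↑ʳ j u w)

select : ∀ {a M n} → (Vec Bool a → Vec Bool M → Vec Bool n) → Vec Bool (a + M) → Vec Bool n
select {a} G x = G (take a x) (drop a x)

select-++ : ∀ {a M n} (G : Vec Bool a → Vec Bool M → Vec Bool n) s y → select G (s ++ y) ≡ G s y
select-++ {a} G s y = cong₂ G (take-++ a s y) (drop-++ a s y)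

_⊗_ : ∀ {a b n₁ n₂} → (Vec Bool a → Vec Bool n₁) → (Vec Bool b → Vec Bool n₂) →
      Vec Bool (a + b) → Vec Bool (n₁ + n₂)
g ⊗ h = select (λ u w → g u ++ h w)

⊗-++ : ∀ {a b n₁ n₂} (g : Vec Bool a → Vec Bool n₁) (h : Vec Bool b → Vec Bool n₂) u w →
  (g ⊗ h) (u ++ w) ≡ g u ++ h w
⊗-++ g h = select-++ (λ u w → g u ++ h w)

-- Prefix decomposition: an edge of {0,1}^(a+M) either changes the index s
-- (contributing a cross distance between neighbouring fibres) or stays in a
-- fibre (contributing to the stretch of that fibre).
stretch-select : ∀ a M {n} (G : Vec Bool a → Vec Bool M → Vec Bool n) →
  stretch (a + M) (select G) ≡
  sumCube a (λ s → sumFin a (λ i → cross M (G s) (G (flipAt i s))) + stretch M (G s))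
stretch-select a M G = begin
    stretch (a + M) (select G)
  ≡⟨ sumCube-++ a M _ ⟩
    sumCube a (λ s → sumCube M (λ y →
      sumFin (a + M) (λ i → dist (select G (s ++ y)) (select G (flipAt i (s ++ y))))))
  ≡⟨ sumCube-cong a (λ s → sumCube-cong M (λ y → edges s y)) ⟩
    sumCube a (λ s → sumCube M (λ y →
      sumFin a (λ i → dist (G s y) (G (flipAt i s) y)) + sumFin M (λ j → dist (G s y) (G s (flipAt j y)))))
  ≡⟨ sumCube-cong a (λ s → trans (sumCube-+ M _ _) (cong (_+ stretch M (G s)) (sumCube-sumFin M a _))) ⟩
    sumCube a (λ s → sumFin a (λ i → cross M (G s) (G (flipAt i s))) + stretch M (G s))
  ∎
  where
  open ≡-Reasoning
  edges : ∀ s y →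
    sumFin (a + M) (λ i → dist (select G (s ++ y)) (select G (flipAt i (s ++ y)))) ≡
    sumFin a (λ i → dist (G s y) (G (flipAt i s) y)) + sumFin M (λ j → dist (G s y) (G s (flipAt j y)))
  edges s y = trans (sumFin-++ a M _) (cong₂ _+_
    (sumFin-cong a (λ i → cong₂ dist (select-++ G s y)
      (trans (cong (select G) (flipAt-↑ˡ i s y)) (select-++ G (flipAt i s) y))))
    (sumFin-cong M (λ j → cong₂ dist (select-++ G s y)
      (trans (cong (select G) (flipAt-↑ʳ j s y)) (select-++ G s (flipAt j y))))))

cross-select : ∀ a M {n} (G G' : Vec Bool a → Vec Bool M → Vec Bool n) →
  cross (a + M) (select G) (select G') ≡ sumCube a (λ s → cross M (G s) (G' s))
cross-select a M G G' =
  trans (sumCube-++ a M _)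
        (sumCube-cong a (λ s → sumCube-cong M (λ y → cong₂ dist (select-++ G s y) (select-++ G' s y))))

-- Stretch of a blockwise product: every edge moves exactly one factor.
stretch-⊗ : ∀ a b {n₁ n₂} (g : Vec Bool a → Vec Bool n₁) (h : Vec Bool b → Vec Bool n₂) →
  stretch (a + b) (g ⊗ h) ≡ 2 ^ b * stretch a g + 2 ^ a * stretch b h
stretch-⊗ a b g h = begin
    stretch (a + b) (g ⊗ h)
  ≡⟨ stretch-select a b (λ u w → g u ++ h w) ⟩
    sumCube a (λ u → sumFin a (λ i → cross b (λ w → g u ++ h w) (λ w → g (flipAt i u) ++ h w))
                     + stretch b (λ w → g u ++ h w))
  ≡⟨ sumCube-cong a (λ u → cong₂ _+_ (sumFin-cong a (λ i → fibreCross u i)) (fibreStretch u)) ⟩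
    sumCube a (λ u → sumFin a (λ i → 2 ^ b * dist (g u) (g (flipAt i u))) + stretch b h)
  ≡⟨ sumCube-+ a _ _ ⟩
    sumCube a (λ u → sumFin a (λ i → 2 ^ b * dist (g u) (g (flipAt i u)))) + sumCube a (λ _ → stretch b h)
  ≡⟨ cong₂ _+_ (trans (sumCube-cong a (λ u → sumFin-*ˡ a (2 ^ b) _)) (sumCube-*ˡ a (2 ^ b) _))
               (sumCube-const a (stretch b h)) ⟩
    2 ^ b * stretch a g + 2 ^ a * stretch b h
  ∎
  where
  open ≡-Reasoning
  fibreCross : ∀ u i → cross b (λ w → g u ++ h w) (λ w → g (flipAt i u) ++ h w)
                       ≡ 2 ^ b * dist (g u) (g (flipAt i u))
  fibreCross u i = trans (cross-prefixed b (g u) (g (flipAt i u)) h h)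
                         (trans (cong (_ +_) (cross-refl b h)) (+-identityʳ _))
  fibreStretch : ∀ u → stretch b (λ w → g u ++ h w) ≡ stretch b h
  fibreStretch u = sumCube-cong b (λ w → sumFin-cong b (λ j → dist-prefix (g u) _ _))

cross-⊗ : ∀ a b {n₁ n₂} (g g' : Vec Bool a → Vec Bool n₁) (h h' : Vec Bool b → Vec Bool n₂) →
  cross (a + b) (g ⊗ h) (g' ⊗ h') ≡ 2 ^ b * cross a g g' + 2 ^ a * cross b h h'
cross-⊗ a b g g' h h' =
  trans (cross-select a b (λ u w → g u ++ h w) (λ u w → g' u ++ h' w))
  (trans (sumCube-cong a (λ u → cross-prefixed b (g u) (g' u) h h'))
  (trans (sumCube-+ a _ _)
         (cong₂ _+_ (sumCube-*ˡ a (2 ^ b) _) (sumCube-const a (cross b h h')))))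

sumCube-scaled : ∀ a R c (d : Vec Bool a → Fin a → ℕ) (w : Vec Bool a → ℕ) →
  sumCube a (λ s → sumFin a (λ i → R * (c * d s i)) + R * w s)
    ≡ R * (c * sumCube a (λ s → sumFin a (d s)) + sumCube a w)
sumCube-scaled a R c d w =
  trans (sumCube-cong a (λ s → trans (cong (_+ R * w s) (trans (sumFin-*ˡ a R _) (cong (R *_) (sumFin-*ˡ a c (d s)))))
                                     (sym (*-distribˡ-+ R _ _))))
  (trans (sumCube-*ˡ a R _)
         (cong (R *_) (trans (sumCube-+ a _ _) (cong (_+ sumCube a w) (sumCube-*ˡ a c _)))))

sum-concatMap : ∀ {X : Set} (g : X → List.List ℕ) xs →
  sum (List.concatMap g xs) ≡ sum (List.map (λ x → sum (g x)) xs)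
sum-concatMap g List.[]       = refl
sum-concatMap g (x List.∷ xs) =
  trans (sum-++ (g x) (List.concatMap g xs)) (cong (sum (g x) +_) (sum-concatMap g xs))

sum-map-++ : ∀ {X : Set} (F : X → ℕ) xs ys →
  sum (List.map F (xs List.++ ys)) ≡ sum (List.map F xs) + sum (List.map F ys)
sum-map-++ F xs ys = trans (cong sum (List.map-++ F xs ys)) (sum-++ (List.map F xs) (List.map F ys))

sum-allVecs : ∀ m (F : Vec Bool m → ℕ) → sum (List.map F (allVecs m)) ≡ sumCube m F
sum-allVecs zero    F = +-identityʳ (F [])
sum-allVecs (suc m) F =
  trans (sum-map-++ F (List.map (false ∷_) (allVecs m)) (List.map (true ∷_) (allVecs m)))
        (cong₂ _+_ (half false) (half true))
  where
  half : ∀ b → sum (List.map F (List.map (b ∷_) (allVecs m))) ≡ sumCube m (λ x → F (b ∷ x))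
  half b = trans (cong sum (sym (List.map-∘ (allVecs m)))) (sum-allVecs m (λ x → F (b ∷ x)))

sum-allFin : ∀ m (h : Fin m → ℕ) → sum (List.map h (List.allFin m)) ≡ sumFin m h
sum-allFin m h = trans (cong sum (List.map-tabulate (λ i → i) h)) (tabulated m h)
  where
  tabulated : ∀ m (h : Fin m → ℕ) → sum (List.tabulate h) ≡ sumFin m h
  tabulated zero    h = refl
  tabulated (suc m) h = cong (h zero +_) (tabulated m (λ i → h (suc i)))

totalStretch≡stretch : ∀ {m} k (φ : Vec Bool m → A k) → totalStretch k φ ≡ stretch m (λ x → proj₁ (φ x))
totalStretch≡stretch {m} k φ =
  trans (sum-concatMap _ (allVecs m))
        (trans (sum-allVecs m _) (sumCube-cong m (λ x → sum-allFin m _)))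

majority : Vec Bool 3 → Bool
majority (a ∷ b ∷ c ∷ []) = maj a b c

-- triple t s : the four triples with majority t, indexed by s ∈ {0,1}^2.
-- The arrangement keeps neighbouring triples, and triple 1 s versus triple 0 s,
-- close (total stretch 12 and cross distance 6, computed below).
triple : Bool → Vec Bool 2 → Vec Bool 3
triple true  (false ∷ false ∷ []) = true  ∷ true  ∷ false ∷ []
triple true  (false ∷ true  ∷ []) = true  ∷ false ∷ true  ∷ []
triple true  (true  ∷ false ∷ []) = false ∷ true  ∷ true  ∷ []
triple true  (true  ∷ true  ∷ []) = true  ∷ true  ∷ true  ∷ []
triple false (false ∷ false ∷ []) = true  ∷ false ∷ false ∷ []
triple false (false ∷ true  ∷ []) = false ∷ false ∷ true  ∷ []
triple false (true  ∷ false ∷ []) = false ∷ true  ∷ false ∷ []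
triple false (true  ∷ true  ∷ []) = false ∷ false ∷ false ∷ []

tripleIndex : Vec Bool 3 → Vec Bool 2
tripleIndex (true  ∷ true  ∷ false ∷ []) = false ∷ false ∷ []
tripleIndex (true  ∷ false ∷ true  ∷ []) = false ∷ true  ∷ []
tripleIndex (false ∷ true  ∷ true  ∷ []) = true  ∷ false ∷ []
tripleIndex (true  ∷ true  ∷ true  ∷ []) = true  ∷ true  ∷ []
tripleIndex (true  ∷ false ∷ false ∷ []) = false ∷ false ∷ []
tripleIndex (false ∷ false ∷ true  ∷ []) = false ∷ true  ∷ []
tripleIndex (false ∷ true  ∷ false ∷ []) = true  ∷ false ∷ []
tripleIndex (false ∷ false ∷ false ∷ []) = true  ∷ true  ∷ []

majority-triple : ∀ t s → majority (triple t s) ≡ t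
majority-triple true  (false ∷ false ∷ []) = refl
majority-triple true  (false ∷ true  ∷ []) = refl
majority-triple true  (true  ∷ false ∷ []) = refl
majority-triple true  (true  ∷ true  ∷ []) = refl
majority-triple false (false ∷ false ∷ []) = refl
majority-triple false (false ∷ true  ∷ []) = refl
majority-triple false (true  ∷ false ∷ []) = refl
majority-triple false (true  ∷ true  ∷ []) = refl

tripleIndex-triple : ∀ t s → tripleIndex (triple t s) ≡ s
tripleIndex-triple true  (false ∷ false ∷ []) = refl
tripleIndex-triple true  (false ∷ true  ∷ []) = refl
tripleIndex-triple true  (true  ∷ false ∷ []) = refl
tripleIndex-triple true  (true  ∷ true  ∷ []) = refl
tripleIndex-triple false (false ∷ false ∷ []) = refl
tripleIndex-triple false (false ∷ true  ∷ []) = refl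
tripleIndex-triple false (true  ∷ false ∷ []) = refl
tripleIndex-triple false (true  ∷ true  ∷ []) = refl

triple-tripleIndex : ∀ r → triple (majority r) (tripleIndex r) ≡ r
triple-tripleIndex (true  ∷ true  ∷ false ∷ []) = refl
triple-tripleIndex (true  ∷ false ∷ true  ∷ []) = refl
triple-tripleIndex (false ∷ true  ∷ true  ∷ []) = refl
triple-tripleIndex (true  ∷ true  ∷ true  ∷ []) = refl
triple-tripleIndex (true  ∷ false ∷ false ∷ []) = refl
triple-tripleIndex (false ∷ false ∷ true  ∷ []) = refl
triple-tripleIndex (false ∷ true  ∷ false ∷ []) = refl
triple-tripleIndex (false ∷ false ∷ false ∷ []) = refl

triple-stretch : ∀ t → stretch 2 (triple t) ≡ 12
triple-stretch true  = refl
triple-stretch false = refl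

triple-cross : cross 2 (triple true) (triple false) ≡ 6
triple-cross = refl

weight : ∀ {n} → (Bool → ℕ) → Vec Bool n → ℕ
weight T []      = 0
weight T (b ∷ p) = T b + weight T p

ones zeros : ∀ {n} → Vec Bool n → ℕ
ones []          = 0
ones (true ∷ p)  = suc (ones p)
ones (false ∷ p) = ones p
zeros []          = 0
zeros (true ∷ p)  = zeros p
zeros (false ∷ p) = suc (zeros p)

weight-count : ∀ {n} (T : Bool → ℕ) (p : Vec Bool n) → weight T p ≡ T true * ones p + T false * zeros p
weight-count T [] = sym (cong₂ _+_ (*-zeroʳ (T true)) (*-zeroʳ (T false)))
weight-count T (true ∷ p) =
  trans (cong (T true +_) (weight-count T p))
        (trans (sym (+-assoc (T true) _ _)) (cong (_+ T false * zeros p) (sym (*-suc (T true) (ones p)))))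
weight-count T (false ∷ p) =
  trans (cong (T false +_) (weight-count T p))
        (trans (leftComm (T false) (T true * ones p) (T false * zeros p)) (cong (T true * ones p +_) (sym (*-suc (T false) (zeros p)))))
  where
  leftComm : ∀ a b c → a + (b + c) ≡ b + (a + c)
  leftComm = solve-∀

sumCube-weight : ∀ m {n} (T : Bool → ℕ) (P : Vec Bool m → Vec Bool n) →
  sumCube m (λ s → weight T (P s))
    ≡ T true * sumCube m (λ s → ones (P s)) + T false * sumCube m (λ s → zeros (P s))
sumCube-weight m T P =
  trans (sumCube-cong m (λ s → weight-count T (P s)))
        (trans (sumCube-+ m _ _) (cong₂ _+_ (sumCube-*ˡ m (T true) _) (sumCube-*ˡ m (T false) _)))

triple-weight : ∀ (T : Bool → ℕ) t → sumCube 2 (λ s → weight T (triple t s)) ≡ T t * 9 + T (not t) * 3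
triple-weight T true  = sumCube-weight 2 T (triple true)
triple-weight T false = trans (sumCube-weight 2 T (triple false)) (+-comm (T true * 3) (T false * 9))

oneBlock : ∀ q x → 1 * x + q * 0 ≡ x
oneBlock q x = trans (cong₂ _+_ (*-identityˡ x) (*-zeroʳ q)) (+-identityʳ x)

scale : ∀ {X} q P x y → X ≡ q * P → X * x + q * (P * y) ≡ X * (x + y)
scale q P x y refl = normal q P x y
  where
  normal : ∀ q P x y → q * P * x + q * (P * y) ≡ q * P * (x + y)
  normal = solve-∀

-- The stretch invariant survives one step (d is the old dimension, 2^d = Q,
-- 2^(2d) = R, and the new size is 2^(2+3d) = 4·Q·R).
stretch-step-arith : ∀ Q R d a b D →
  a + 2 * D ≤ 20 * (Q * d) + 2 * Q → b + 2 * D ≤ 20 * (Q * d) + 2 * Q →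
  R * (D * 12 + (a * 9 + b * 3)) + 2 * (R * (D * 6))
    ≤ 20 * (2 * (2 * (Q * R)) * (2 + 3 * d)) + 2 * (2 * (2 * (Q * R)))
stretch-step-arith Q R d a b D ha hb = begin
    R * (D * 12 + (a * 9 + b * 3)) + 2 * (R * (D * 6))
  ≡⟨ regroup R D a b ⟩
    R * ((a + 2 * D) * 9 + (b + 2 * D) * 3)
  ≤⟨ *-monoʳ-≤ R (+-mono-≤ (*-monoˡ-≤ 9 ha) (*-monoˡ-≤ 3 hb)) ⟩
    R * ((20 * (Q * d) + 2 * Q) * 9 + (20 * (Q * d) + 2 * Q) * 3)
  ≡⟨ expand Q R d ⟩
    240 * (Q * R * d) + 24 * (Q * R)
  ≤⟨ m≤m+n _ (144 * (Q * R)) ⟩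
    240 * (Q * R * d) + 24 * (Q * R) + 144 * (Q * R)
  ≡⟨ target Q R d ⟩
    20 * (2 * (2 * (Q * R)) * (2 + 3 * d)) + 2 * (2 * (2 * (Q * R)))
  ∎
  where
  open ≤-Reasoning
  regroup : ∀ R D a b → R * (D * 12 + (a * 9 + b * 3)) + 2 * (R * (D * 6))
                        ≡ R * ((a + 2 * D) * 9 + (b + 2 * D) * 3)
  regroup = solve-∀
  expand : ∀ Q R d → R * ((20 * (Q * d) + 2 * Q) * 9 + (20 * (Q * d) + 2 * Q) * 3)
                     ≡ 240 * (Q * R * d) + 24 * (Q * R)
  expand = solve-∀
  target : ∀ Q R d → 240 * (Q * R * d) + 24 * (Q * R) + 144 * (Q * R)
                     ≡ 20 * (2 * (2 * (Q * R)) * (2 + 3 * d)) + 2 * (2 * (2 * (Q * R)))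
  target = solve-∀

gap-step-arith : ∀ Q R D → Q ≤ D → 2 * (2 * (Q * R)) ≤ R * (D * 6)
gap-step-arith Q R D h = begin
    2 * (2 * (Q * R))
  ≤⟨ m≤m+n _ (2 * (Q * R)) ⟩
    2 * (2 * (Q * R)) + 2 * (Q * R)
  ≡⟨ six Q R ⟩
    R * (Q * 6)
  ≤⟨ *-monoʳ-≤ R (*-monoˡ-≤ 6 h) ⟩
    R * (D * 6)
  ∎
  where
  open ≤-Reasoning
  six : ∀ Q R → 2 * (2 * (Q * R)) + 2 * (Q * R) ≡ R * (Q * 6)
  six = solve-∀

dim : ℕ → ℕ
dim zero    = 0
dim (suc k) = 2 + 3 * dim k

dim≡ : ∀ k → dim k ≡ 3 ^ k ∸ 1
dim≡ k = cong (_∸ 1) (suc-dim k)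
  where
  threefold : ∀ d → suc (2 + 3 * d) ≡ 3 * suc d
  threefold = solve-∀
  suc-dim : ∀ k → suc (dim k) ≡ 3 ^ k
  suc-dim zero    = refl
  suc-dim (suc k) = trans (threefold (dim k)) (cong (3 *_) (suc-dim k))

-- encode b is a bijection from {0,1}^(dim k) onto the inputs z with
-- recMaj k z ≡ b; decode inverts both halves at once.
record Encoding (k : ℕ) : Set where
  field
    encode        : Bool → Vec Bool (dim k) → Vec Bool (3 ^ k)
    decode        : Vec Bool (3 ^ k) → Vec Bool (dim k)
    recMaj-encode : ∀ b y → recMaj k (encode b y) ≡ b
    decode-encode : ∀ b y → decode (encode b y) ≡ y
    encode-decode : ∀ z → encode (recMaj k z) (decode z) ≡ z

  halfStretch : Bool → ℕ
  halfStretch b = stretch (dim k) (encode b)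

  gap : ℕ
  gap = cross (dim k) (encode true) (encode false)

record Level (k : ℕ) : Set where
  field
    encoding : Encoding k
  open Encoding encoding
  field
    stretch-bound : ∀ b → halfStretch b + 2 * gap ≤ 20 * (2 ^ dim k * dim k) + 2 * 2 ^ dim k
    gap-bound     : 2 ^ dim k ≤ gap

level₀ : Level 0
level₀ = record
  { encoding = record
    { encode        = λ b _ → b ∷ []
    ; decode        = λ _ → []
    ; recMaj-encode = λ b y → refl
    ; decode-encode = λ { b [] → refl }
    ; encode-decode = λ { (z ∷ []) → refl }
    }
  ; stretch-bound = λ b → ≤-refl
  ; gap-bound     = ≤-refl
  }

module Step {k : ℕ} (E : Encoding k) where
  open Encoding E

  m N Q R : ℕ
  m = dim k
  N = 3 ^ k
  Q = 2 ^ m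
  R = 2 ^ (2 * m)

  blocks : ∀ {r} → Vec Bool r → Vec Bool (r * m) → Vec Bool (r * N)
  blocks []      = λ _ → []
  blocks (b ∷ p) = encode b ⊗ blocks p

  labels : ∀ r → Vec Bool (r * N) → Vec Bool r
  labels zero    = λ _ → []
  labels (suc r) = (λ z → recMaj k z ∷ []) ⊗ labels r

  decodes : ∀ r → Vec Bool (r * N) → Vec Bool (r * m)
  decodes zero    = λ _ → []
  decodes (suc r) = decode ⊗ decodes r

  labels-blocks : ∀ {r} (p : Vec Bool r) y → labels r (blocks p y) ≡ p
  labels-blocks         []      y = refl
  labels-blocks {suc r} (b ∷ p) y =
    trans (⊗-++ (λ z → recMaj k z ∷ []) (labels r) (encode b (take m y)) (blocks p (drop m y)))
          (cong₂ _∷_ (recMaj-encode b (take m y)) (labels-blocks p (drop m y)))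

  decodes-blocks : ∀ {r} (p : Vec Bool r) y → decodes r (blocks p y) ≡ y
  decodes-blocks         []      [] = refl
  decodes-blocks {suc r} (b ∷ p) y  =
    trans (⊗-++ decode (decodes r) (encode b (take m y)) (blocks p (drop m y)))
          (trans (cong₂ _++_ (decode-encode b (take m y)) (decodes-blocks p (drop m y)))
                 (take++drop≡id m y))

  blocks-decodes : ∀ r z → blocks (labels r z) (decodes r z) ≡ z
  blocks-decodes zero    [] = refl
  blocks-decodes (suc r) z  =
    trans (⊗-++ (encode (recMaj k (take N z))) (blocks (labels r (drop N z)))
                (decode (take N z)) (decodes r (drop N z)))
          (trans (cong₂ _++_ (encode-decode (take N z)) (blocks-decodes r (drop N z)))
                 (take++drop≡id N z))

  recMaj-labels : ∀ z → recMaj (suc k) z ≡ majority (labels 3 z)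
  recMaj-labels z = refl

  encode′ : Bool → Vec Bool (dim (suc k)) → Vec Bool (3 ^ suc k)
  encode′ t = select (λ s → blocks (triple t s))

  decode′ : Vec Bool (3 ^ suc k) → Vec Bool (dim (suc k))
  decode′ z = tripleIndex (labels 3 z) ++ decodes 3 z

  recMaj-encode′ : ∀ t x → recMaj (suc k) (encode′ t x) ≡ t
  recMaj-encode′ t x =
    trans (recMaj-labels (encode′ t x))
    (trans (cong majority (labels-blocks (triple t (take 2 x)) (drop 2 x))) (majority-triple t (take 2 x)))

  decode-encode′ : ∀ t x → decode′ (encode′ t x) ≡ x
  decode-encode′ t x =
    trans (cong₂ _++_ (trans (cong tripleIndex (labels-blocks (triple t (take 2 x)) (drop 2 x)))
                             (tripleIndex-triple t (take 2 x)))
                      (decodes-blocks (triple t (take 2 x)) (drop 2 x)))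
          (take++drop≡id 2 x)

  encode-decode′ : ∀ z → encode′ (recMaj (suc k) z) (decode′ z) ≡ z
  encode-decode′ z =
    trans (select-++ (λ s → blocks (triple (majority (labels 3 z)) s)) (tripleIndex (labels 3 z)) (decodes 3 z))
          (trans (cong (λ p → blocks p (decodes 3 z)) (triple-tripleIndex (labels 3 z)))
                 (blocks-decodes 3 z))

  next : Encoding (suc k)
  next = record
    { encode        = encode′
    ; decode        = decode′
    ; recMaj-encode = recMaj-encode′
    ; decode-encode = decode-encode′
    ; encode-decode = encode-decode′
    }

  cross-encode : ∀ b b' → cross m (encode b) (encode b') ≡ gap * dist (b ∷ []) (b' ∷ [])
  cross-encode true  true  = trans (cross-refl m (encode true)) (sym (*-zeroʳ gap))
  cross-encode true  false = sym (*-identityʳ gap)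
  cross-encode false true  = trans (cross-sym m (encode false) (encode true)) (sym (*-identityʳ gap))
  cross-encode false false = trans (cross-refl m (encode false)) (sym (*-zeroʳ gap))

  -- Each of r + 1 blocks contributes the stretch of its encoding, once for
  -- every choice of the other r blocks.
  blocks-stretch : ∀ {r} (p : Vec Bool (suc r)) →
    stretch (suc r * m) (blocks p) ≡ 2 ^ (r * m) * weight halfStretch p
  blocks-stretch {zero} (b ∷ []) =
    trans (stretch-⊗ m 0 (encode b) (blocks [])) (trans (oneBlock Q (halfStretch b))
          (sym (trans (*-identityˡ _) (+-identityʳ (halfStretch b)))))
  blocks-stretch {suc r} (b ∷ p) = begin
      stretch (m + suc r * m) (encode b ⊗ blocks p)
    ≡⟨ stretch-⊗ m (suc r * m) (encode b) (blocks p) ⟩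
      2 ^ (suc r * m) * halfStretch b + Q * stretch (suc r * m) (blocks p)
    ≡⟨ cong (λ v → 2 ^ (suc r * m) * halfStretch b + Q * v) (blocks-stretch p) ⟩
      2 ^ (suc r * m) * halfStretch b + Q * (2 ^ (r * m) * weight halfStretch p)
    ≡⟨ scale Q (2 ^ (r * m)) _ _ (^-distribˡ-+-* 2 m (r * m)) ⟩
      2 ^ (suc r * m) * weight halfStretch (b ∷ p)
    ∎
    where open ≡-Reasoning

  blocks-cross : ∀ {r} (p p' : Vec Bool (suc r)) →
    cross (suc r * m) (blocks p) (blocks p') ≡ 2 ^ (r * m) * (gap * dist p p')
  blocks-cross {zero} (b ∷ []) (b' ∷ []) =
    trans (cross-⊗ m 0 (encode b) (encode b') (blocks []) (blocks []))
          (trans (oneBlock Q _) (trans (cross-encode b b') (sym (*-identityˡ _))))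
  blocks-cross {suc r} (b ∷ p) (b' ∷ p') = begin
      cross (m + suc r * m) (encode b ⊗ blocks p) (encode b' ⊗ blocks p')
    ≡⟨ cross-⊗ m (suc r * m) (encode b) (encode b') (blocks p) (blocks p') ⟩
      2 ^ (suc r * m) * cross m (encode b) (encode b') + Q * cross (suc r * m) (blocks p) (blocks p')
    ≡⟨ cong₂ (λ u v → 2 ^ (suc r * m) * u + Q * v) (cross-encode b b') (blocks-cross p p') ⟩
      2 ^ (suc r * m) * (gap * dist (b ∷ []) (b' ∷ [])) + Q * (2 ^ (r * m) * (gap * dist p p'))
    ≡⟨ scale Q (2 ^ (r * m)) _ _ (^-distribˡ-+-* 2 m (r * m)) ⟩
      2 ^ (suc r * m) * (gap * dist (b ∷ []) (b' ∷ []) + gap * dist p p')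
    ≡⟨ cong (2 ^ (suc r * m) *_) (trans (sym (*-distribˡ-+ gap _ _))
                                        (cong (gap *_) (sym (dist-++ (b ∷ []) (b' ∷ []) p p')))) ⟩
      2 ^ (suc r * m) * (gap * dist (b ∷ p) (b' ∷ p'))
    ∎
    where open ≡-Reasoning

  stretch-next : ∀ t → stretch (dim (suc k)) (encode′ t)
                       ≡ R * (gap * 12 + (halfStretch t * 9 + halfStretch (not t) * 3))
  stretch-next t = begin
      stretch (2 + 3 * m) (encode′ t)
    ≡⟨ stretch-select 2 (3 * m) (λ s → blocks (triple t s)) ⟩
      sumCube 2 (λ s → sumFin 2 (λ i → cross (3 * m) (blocks (triple t s)) (blocks (triple t (flipAt i s))))
                       + stretch (3 * m) (blocks (triple t s)))
    ≡⟨ sumCube-cong 2 (λ s → cong₂ _+_ (sumFin-cong 2 (λ i → blocks-cross (triple t s) (triple t (flipAt i s))))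
                                       (blocks-stretch (triple t s))) ⟩
      sumCube 2 (λ s → sumFin 2 (λ i → R * (gap * dist (triple t s) (triple t (flipAt i s))))
                       + R * weight halfStretch (triple t s))
    ≡⟨ sumCube-scaled 2 R gap (λ s i → dist (triple t s) (triple t (flipAt i s)))
                              (λ s → weight halfStretch (triple t s)) ⟩
      R * (gap * stretch 2 (triple t) + sumCube 2 (λ s → weight halfStretch (triple t s)))
    ≡⟨ cong (R *_) (cong₂ _+_ (cong (gap *_) (triple-stretch t)) (triple-weight halfStretch t)) ⟩
      R * (gap * 12 + (halfStretch t * 9 + halfStretch (not t) * 3))
    ∎
    where open ≡-Reasoning

  gap-next : cross (dim (suc k)) (encode′ true) (encode′ false) ≡ R * (gap * 6)
  gap-next =
    trans (cross-select 2 (3 * m) (λ s → blocks (triple true s)) (λ s → blocks (triple false s)))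
    (trans (sumCube-cong 2 (λ s → blocks-cross (triple true s) (triple false s)))
    (trans (sumCube-*ˡ 2 R (λ s → gap * dist (triple true s) (triple false s)))
           (cong (R *_) (trans (sumCube-*ˡ 2 gap (λ s → dist (triple true s) (triple false s)))
                               (cong (gap *_) triple-cross)))))

  size-next : 2 ^ dim (suc k) ≡ 2 * (2 * (Q * R))
  size-next = cong (λ v → 2 * (2 * v)) (^-distribˡ-+-* 2 m (2 * m))

level-step : ∀ {k} → Level k → Level (suc k)
level-step {k} L = record
  { encoding      = next
  ; stretch-bound = λ t →
      subst₂ _≤_ (sym (cong₂ _+_ (stretch-next t) (cong (2 *_) gap-next)))
                 (sym (cong (λ P → 20 * (P * dim (suc k)) + 2 * P) size-next))
                 (stretch-step-arith Q R (dim k) (halfStretch t) (halfStretch (not t)) gap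
                                     (stretch-bound t) (stretch-bound (not t)))
  ; gap-bound     = subst₂ _≤_ (sym size-next) (sym gap-next) (gap-step-arith Q R gap gap-bound)
  }
  where
  open Level L
  open Encoding encoding
  open Step encoding

level : ∀ k → Level k
level zero    = level₀
level (suc k) = level-step (level k)

encode-stretch : ∀ k → Encoding.halfStretch (Level.encoding (level k)) true ≤ 20 * (2 ^ dim k * dim k)
encode-stretch k =
  +-cancelʳ-≤ (2 * 2 ^ dim k) (halfStretch true) _
    (≤-trans (+-monoʳ-≤ (halfStretch true) (*-monoʳ-≤ 2 gap-bound)) (stretch-bound true))
  where
  open Level (level k)
  open Encoding encoding

A-≡ : ∀ {k} {z z' : Vec Bool (3 ^ k)} {p : recMaj k z ≡ true} {p' : recMaj k z' ≡ true} →
  z ≡ z' → (z , p) ≡ (z' , p')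
A-≡ refl = cong (_ ,_) (Decidable⇒UIP.≡-irrelevant _≟ᵇ_ _ _)

GoodEmbedding : ℕ → ℕ → Set
GoodEmbedding d k = Σ (Vec Bool d → A k) (λ φ → Bijective≡ φ × AvgStretch≤ k φ 20)

goodEmbedding : ∀ k → GoodEmbedding (dim k) k
goodEmbedding k = φ , (φ-injective , φ-surjective) , φ-stretch
  where
  open Level (level k)
  open Encoding encoding
  φ : Vec Bool (dim k) → A k
  φ y = encode true y , recMaj-encode true y
  φ-injective : ∀ {x y} → φ x ≡ φ y → x ≡ y
  φ-injective {x} {y} e =
    trans (sym (decode-encode true x)) (trans (cong (λ w → decode (proj₁ w)) e) (decode-encode true y))
  φ-surjective : ∀ w → Σ (Vec Bool (dim k)) (λ x → ∀ {y} → y ≡ x → φ y ≡ w)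
  φ-surjective (z , pz) =
    decode z , λ { refl → A-≡ {k} (subst (λ b → encode b (decode z) ≡ z) pz (encode-decode z)) }
  φ-stretch : AvgStretch≤ k φ 20
  φ-stretch = subst (_≤ 20 * (2 ^ dim k * dim k)) (sym (totalStretch≡stretch k φ)) (encode-stretch k)

theorem3 : (k : ℕ) → 1 ≤ k →
    Σ (Vec Bool (3 ^ k ∸ 1) → A k)
      (λ φ → Bijective≡ φ × AvgStretch≤ k φ 20)
theorem3 k _ = subst (λ d → GoodEmbedding d k) (dim≡ k) (goodEmbedding k)
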